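{- Let $\varepsilon\ge 0$ and $\alpha\ge 1$. For any \texttt{3-PARTITION} instance with integers $a_1,\dots,a_{3k}$ and threshold $s$, let $G$ be a solid grid graph with $n$ vertices consisting of $3k$ rectangular grids $G_1,\dots,G_{3k}$ connected in a row, consecutive grids joined by an edge between the lower right vertex of one and the lower left vertex of the next, using $m=3k-1$ edges in total, where $G_i$ has height $h=\bigl\lceil\sqrt{(3k\alpha)^2+\varepsilon n}\,\bigr\rceil$ and width $h\,a_i$. If $\varepsilon$ and $\alpha$ are values for which these grids exist, then these graphs form a reduction set for \texttt{$k$-BALANCED PARTITIONING} with parameters $m=3k-1$, $p=h^2$, $\varepsilon$, $\alpha$; that is, any partition of the $n$ vertices of $G$ into $k$ sets with cut size at most $\alpha m$ induces fewer than $p-\varepsilon n$ minority vertices in total.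
   Context: \texttt{3-PARTITION}: given $3k$ integers $a_1,\dots,a_{3k}$ and a threshold $s$ with $s/4<a_i<s/2$ for all $i$ and $\sum_{i=1}^{3k}a_i=ks$, find a partition into $k$ triples each summing to $s$. A rectangular grid graph is the Cartesian product of two paths, embedded naturally with vertices at integer points of the plane and unit-length edges; its width is the number of vertices sharing a common $y$-coordinate and its height the number sharing a common $x$-coordinate. A solid grid graph is a connected finite subgraph of the infinite 2D grid with no interior face bounded by more than four edges. The cut size of a partition is the number of edges joining different sets. A partition into $k$ sets induces a $k$-colouring; a minority vertex in gadget $G_i$ is a vertex whose colour is shared by fewer than half of $G_i$'s vertices. A reduction set for \texttt{$k$-BALANCED PARTITIONING} contains, for each \texttt{3-PARTITION} instance, a graph with parameters $m\ge0$, $p\ge1$, $\varepsilon\ge0$, $\alpha\ge1$, consisting of $3k$ disjoint gadgets connected by $m$ edges, gadget $G_i$ having $pa_i$ vertices, such that any partition of its $n$ vertices into $k$ sets of cut size at most $\alpha m$ yields fewer than $p-\varepsilon n$ minority vertices in total.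
   Formalization: The parameters ε and α range over the rationals. -}

module Defs where

open import Data.Nat using (ℕ; zero; suc; _+_; _*_; _∸_; _<?_; _^_)
import Data.Nat as N
open import Data.Fin using (Fin; toℕ) renaming (zero to fzero; suc to fsuc)
import Data.Fin as F
open import Data.Bool using (if_then_else_)
open import Data.Product using (_×_)
open import Data.Integer using (+_)
open import Data.Rational using (ℚ; _/_; _≤_; _<_) renaming (_+_ to _+ℚ_; _*_ to _*ℚ_)
open import Relation.Nullary using (Dec)
open import Relation.Binary.PropositionalEquality using (_≡_)
open import Relation.Nullary.Decidable using (⌊_⌋; ¬?; _×-dec_)

ℕ→ℚ : ℕ → ℚ
ℕ→ℚ n = (+ n) / 1

∑ : (n : ℕ) → (Fin n → ℕ) → ℕ
∑ zero    f = 0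
∑ (suc n) f = f fzero + ∑ n (λ i → f (fsuc i))

⟦_⟧ : {P : Set} → Dec P → ℕ
⟦ d ⟧ = if ⌊ d ⌋ then 1 else 0

-- h is the ceiling of the square root of X (X ≥ 0):
-- the least natural number whose square is at least X.
IsCeilSqrt : ℚ → ℕ → Set
IsCeilSqrt X h = (X ≤ ℕ→ℚ (h ^ 2)) × (∀ (m : ℕ) → X ≤ ℕ→ℚ (m ^ 2) → h N.≤ m)

-- 3-PARTITION instances: 3k integers a_i and threshold s with
-- s/4 < a_i < s/2 and  Σ a_i = k s.  (These force s > 0 and a_i > 0,
-- so we use natural numbers.)

record ThreePartitionInstance (k : ℕ) : Set where
  field
    a      : Fin (3 * k) → ℕ
    s      : ℕ
    lower  : ∀ i → s N.< 4 * a i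
    upper  : ∀ i → 2 * a i N.< s
    total  : ∑ (3 * k) a ≡ k * s

-- Gadget i (i : Fin N) is the rectangular grid with width w i and height h;
-- its vertices are (i , x , y) with x : Fin (w i), y : Fin h.
-- Edges: (i,x,y)-(i,x+1,y), (i,x,y)-(i,x,y+1) inside gadgets, and for each
-- consecutive pair i, i+1 the edge from the lower-right vertex
-- (i , w i - 1 , 0) of G_i to the lower-left vertex (i+1 , 0 , 0) of G_{i+1}.

-- a partition of the vertex set into k sets, as a k-colouring
Colouring : (k N' : ℕ) → (w : Fin N' → ℕ) → (h : ℕ) → Set
Colouring k N' w h = (i : Fin N') → Fin (w i) → Fin h → Fin k

numVertices : (N' : ℕ) → (w : Fin N' → ℕ) → (h : ℕ) → ℕ
numVertices N' w h = ∑ N' (λ i → w i * h)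

module _ {k N' : ℕ} {w : Fin N' → ℕ} {h : ℕ} (c : Colouring k N' w h) where

  horizontalCut : Fin N' → ℕ
  horizontalCut i =
    ∑ (w i) λ x → ∑ (w i) λ x' → ∑ h λ y →
      ⟦ (toℕ x' N.≟ suc (toℕ x)) ×-dec ¬? (c i x y F.≟ c i x' y) ⟧

  verticalCut : Fin N' → ℕ
  verticalCut i =
    ∑ (w i) λ x → ∑ h λ y → ∑ h λ y' →
      ⟦ (toℕ y' N.≟ suc (toℕ y)) ×-dec ¬? (c i x y F.≟ c i x y') ⟧

  connectingCut : ℕ
  connectingCut =
    ∑ N' λ i → ∑ N' λ j → ∑ (w i) λ x → ∑ h λ y → ∑ (w j) λ x' → ∑ h λ y' →
      ⟦ (toℕ j N.≟ suc (toℕ i)) ×-dec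
        ((toℕ x N.≟ w i ∸ 1) ×-dec ((toℕ y N.≟ 0) ×-dec
        ((toℕ x' N.≟ 0) ×-dec ((toℕ y' N.≟ 0) ×-dec
        ¬? (c i x y F.≟ c j x' y'))))) ⟧

  cutSize : ℕ
  cutSize = ∑ N' (λ i → horizontalCut i + verticalCut i) + connectingCut

  colourCount : Fin N' → Fin k → ℕ
  colourCount i col = ∑ (w i) λ x → ∑ h λ y → ⟦ c i x y F.≟ col ⟧

  minorityCount : ℕ
  minorityCount =
    ∑ N' λ i → ∑ (w i) λ x → ∑ h λ y →
      ⟦ 2 * colourCount i (c i x y) <? w i * h ⟧

module Submission where

-- Let T be the cut size.  The rational hypotheses give
-- T ≤ α(3k-1) < 3kα, hence T² < (3kα)² ≤ h² - εn; in particular T < h.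
-- Fix a gadget G_i (a grid of width W = h·a_i ≥ h and height h) and let
-- H, V be its numbers of horizontal and vertical cut edges, H + V ≤ T < h.
-- Fewer than h rows and fewer than W columns contain a cut edge, so some
-- row y₀ and some column x₀ are monochromatic, with common colour c₀.
-- A vertex (x,y) not coloured c₀ must have a cut edge in column x and one
-- in row y; hence at most V·H ≤ (V+H)²/2 ≤ W·h/2 vertices avoid c₀, so
-- c₀ is a majority colour and G_i has at most V·H minority vertices.
-- Summing over gadgets, the minority count is at most ∑(V_i+H_i)·T ≤ T².

module RowOfGrids where

  open import Defs
  open import Data.Nat using (ℕ; zero; suc; _+_; _*_; _^_; _<?_; z≤n; s≤s)
  import Data.Nat as N
  import Data.Nat.Properties as NP
  open import Data.Fin using (Fin; toℕ) renaming (zero to fzero; suc to fsuc)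
  import Data.Fin as F
  open import Data.Fin.Induction using (<-weakInduction)
  open import Data.Fin.Properties using (toℕ-inject₁)
  open import Data.Product using (_,_; Σ; proj₁; proj₂)
  open import Data.Empty using (⊥-elim)
  open import Function using (_∘_; flip)
  open import Relation.Nullary using (Dec; yes; no; ¬_)
  open import Relation.Nullary.Decidable using (¬?; _×-dec_; decidable-stable)
  open import Relation.Binary.PropositionalEquality
  open import Data.Nat.Solver using (module +-*-Solver)
  open import Algebra.Properties.CommutativeMonoid.Sum NP.+-0-commutativeMonoid
    using (sum; ∑-comm; ∑-distrib-+)
  open import Algebra.Properties.Semiring.Sum NP.+-*-semiring
    using (*-distribˡ-sum; *-distribʳ-sum)

  -- Finite sums.  Defs.∑ is the library's vector sum in (ℕ, +, 0), which
  -- lets us reuse the library's interchange and distributivity laws.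

  ∑-cong : ∀ n {f g : Fin n → ℕ} → (∀ i → f i ≡ g i) → ∑ n f ≡ ∑ n g
  ∑-cong zero    e = refl
  ∑-cong (suc n) e = cong₂ _+_ (e fzero) (∑-cong n (e ∘ fsuc))

  ∑-mono : ∀ n {f g : Fin n → ℕ} → (∀ i → f i N.≤ g i) → ∑ n f N.≤ ∑ n g
  ∑-mono zero    e = z≤n
  ∑-mono (suc n) e = NP.+-mono-≤ (e fzero) (∑-mono n (e ∘ fsuc))

  ∑≡sum : ∀ n (f : Fin n → ℕ) → ∑ n f ≡ sum f
  ∑≡sum zero    f = refl
  ∑≡sum (suc n) f = cong (f fzero +_) (∑≡sum n (f ∘ fsuc))

  ∑≡sum² : ∀ n m (f : Fin n → Fin m → ℕ) →
    ∑ n (λ i → ∑ m (f i)) ≡ sum (λ i → sum (f i))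
  ∑≡sum² n m f = trans (∑-cong n (λ i → ∑≡sum m (f i))) (∑≡sum n _)

  ∑-swap : ∀ n m (f : Fin n → Fin m → ℕ) →
    ∑ n (λ i → ∑ m (f i)) ≡ ∑ m (λ j → ∑ n (λ i → f i j))
  ∑-swap n m f = trans (∑≡sum² n m f) (trans (∑-comm f) (sym (∑≡sum² m n (flip f))))

  ∑-+ : ∀ n (f g : Fin n → ℕ) → ∑ n (λ i → f i + g i) ≡ ∑ n f + ∑ n g
  ∑-+ n f g = begin
    ∑ n (λ i → f i + g i)  ≡⟨ ∑≡sum n _ ⟩
    sum (λ i → f i + g i)  ≡⟨ ∑-distrib-+ f g ⟩
    sum f + sum g          ≡⟨ sym (cong₂ _+_ (∑≡sum n f) (∑≡sum n g)) ⟩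
    ∑ n f + ∑ n g          ∎
    where open ≡-Reasoning

  ∑-*ʳ : ∀ n a (f : Fin n → ℕ) → ∑ n (λ i → f i * a) ≡ ∑ n f * a
  ∑-*ʳ n a f = begin
    ∑ n (λ i → f i * a)  ≡⟨ ∑≡sum n _ ⟩
    sum (λ i → f i * a)  ≡⟨ sym (*-distribʳ-sum a f) ⟩
    sum f * a            ≡⟨ cong (_* a) (sym (∑≡sum n f)) ⟩
    ∑ n f * a            ∎
    where open ≡-Reasoning

  ∑-product : ∀ n m (f : Fin n → ℕ) (g : Fin m → ℕ) →
    ∑ n (λ i → ∑ m (λ j → f i * g j)) ≡ ∑ n f * ∑ m g
  ∑-product n m f g = begin
    ∑ n (λ i → ∑ m (λ j → f i * g j))  ≡⟨ ∑-cong n (λ i → ∑≡sum m _) ⟩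
    ∑ n (λ i → sum (λ j → f i * g j))  ≡⟨ ∑-cong n (λ i → sym (*-distribˡ-sum (f i) g)) ⟩
    ∑ n (λ i → f i * sum g)            ≡⟨ ∑-*ʳ n (sum g) f ⟩
    ∑ n f * sum g                      ≡⟨ cong (∑ n f *_) (sym (∑≡sum m g)) ⟩
    ∑ n f * ∑ m g                      ∎
    where open ≡-Reasoning

  ∑-const : ∀ n a → ∑ n (λ _ → a) ≡ n * a
  ∑-const zero    a = refl
  ∑-const (suc n) a = cong (a +_) (∑-const n a)

  term≤∑ : ∀ n (f : Fin n → ℕ) i → f i N.≤ ∑ n f
  term≤∑ (suc n) f fzero    = NP.m≤m+n _ _
  term≤∑ (suc n) f (fsuc i) = NP.≤-trans (term≤∑ n (f ∘ fsuc) i) (NP.m≤n+m _ (f fzero))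

  ∑≡0⇒term≡0 : ∀ n (f : Fin n → ℕ) → ∑ n f ≡ 0 → ∀ i → f i ≡ 0
  ∑≡0⇒term≡0 n f e i = NP.n≤0⇒n≡0 (subst (f i N.≤_) e (term≤∑ n f i))

  ∑<n⇒term≡0 : ∀ n (f : Fin n → ℕ) → ∑ n f N.< n → Σ (Fin n) (λ i → f i ≡ 0)
  ∑<n⇒term≡0 (suc n) f lt with f fzero in eq
  ... | zero  = fzero , eq
  ... | suc a with ∑<n⇒term≡0 n (f ∘ fsuc) (NP.≤-trans (s≤s (NP.m≤n+m _ a)) (N.s≤s⁻¹ lt))
  ...   | i , e = fsuc i , e

  ⟦⟧≡0⇒¬ : ∀ {P : Set} (d : Dec P) → ⟦ d ⟧ ≡ 0 → ¬ P
  ⟦⟧≡0⇒¬ (no ¬p) _ = ¬p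

  ⟦⟧-≤ : ∀ {P : Set} (d : Dec P) {n : ℕ} → (P → 1 N.≤ n) → ⟦ d ⟧ N.≤ n
  ⟦⟧-≤ (yes p) bound = bound p
  ⟦⟧-≤ (no _)  bound = z≤n

  ⟦⟧-mono : ∀ {P Q : Set} (d : Dec P) (e : Dec Q) → (P → Q) → ⟦ d ⟧ N.≤ ⟦ e ⟧
  ⟦⟧-mono d (yes q) P⇒Q = ⟦⟧-≤ d (λ _ → NP.≤-refl)
  ⟦⟧-mono d (no ¬q) P⇒Q = ⟦⟧-≤ d (λ p → ⊥-elim (¬q (P⇒Q p)))

  ⟦⟧+⟦¬⟧ : ∀ {P : Set} (d : Dec P) → ⟦ d ⟧ + ⟦ ¬? d ⟧ ≡ 1
  ⟦⟧+⟦¬⟧ (yes _) = refl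
  ⟦⟧+⟦¬⟧ (no _)  = refl

  -- Paths.  pathCut n g counts the edges x — x+1 of the path on Fin n
  -- whose endpoints get different colours under g.  Rows and columns of a
  -- gadget are such paths.

  module _ {k : ℕ} where

    pathCut : ∀ n → (Fin n → Fin k) → ℕ
    pathCut n g = ∑ n λ x → ∑ n λ x' →
      ⟦ (toℕ x' N.≟ suc (toℕ x)) ×-dec ¬? (g x F.≟ g x') ⟧

    pathCut≡0⇒adjacent : ∀ n (g : Fin n → Fin k) → pathCut n g ≡ 0 →
      ∀ x x' → toℕ x' ≡ suc (toℕ x) → g x ≡ g x'
    pathCut≡0⇒adjacent n g noCut x x' adj =
      decidable-stable (g x F.≟ g x') (λ differ → ⟦⟧≡0⇒¬ _ term≡0 (adj , differ))
      where
      term≡0 : ⟦ (toℕ x' N.≟ suc (toℕ x)) ×-dec ¬? (g x F.≟ g x') ⟧ ≡ 0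
      term≡0 = ∑≡0⇒term≡0 n _ (∑≡0⇒term≡0 n _ noCut x) x'

    pathCut≡0⇒constant : ∀ n (g : Fin n → Fin k) → pathCut n g ≡ 0 →
      ∀ a b → g a ≡ g b
    pathCut≡0⇒constant (suc n) g noCut a b = trans (≡g₀ a) (sym (≡g₀ b))
      where
      ≡g₀ : ∀ i → g i ≡ g fzero
      ≡g₀ = <-weakInduction (λ i → g i ≡ g fzero) refl λ j gj≡g₀ →
        trans (sym (pathCut≡0⇒adjacent (suc n) g noCut (F.inject₁ j) (fsuc j)
                     (cong suc (sym (toℕ-inject₁ j)))))
              gj≡g₀

  2ab≤[a+b]² : ∀ a b → 2 * (a * b) N.≤ (a + b) * (a + b)
  2ab≤[a+b]² a b = subst (2 * (a * b) N.≤_) (sym (expand a b)) (NP.m≤m+n _ _)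
    where
    open +-*-Solver
    expand : ∀ a b → (a + b) * (a + b) ≡ 2 * (a * b) + (a * a + b * b)
    expand = solve 2 (λ a b → (a :+ b) :* (a :+ b) := con 2 :* (a :* b) :+ (a :* a :+ b :* b)) refl

  module Gadget {k N' : ℕ} {w : Fin N' → ℕ} {h : ℕ}
                (c : Colouring k N' w h) (i : Fin N') where

    W : ℕ
    W = w i

    rowCut : Fin h → ℕ
    rowCut y = pathCut W (λ x → c i x y)

    columnCut : Fin W → ℕ
    columnCut x = pathCut h (c i x)

    -- the cut edges of G_i, sorted by rows (horizontal) and columns (vertical);
    -- for columns this is definitional
    horizontalCut≡ : horizontalCut c i ≡ ∑ h rowCut
    horizontalCut≡ = trans (∑-cong W (λ x → ∑-swap W h _)) (∑-swap W h _)

    others : Fin k → ℕ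
    others col = ∑ W λ x → ∑ h λ y → ⟦ ¬? (c i x y F.≟ col) ⟧

    minority : ℕ
    minority = ∑ W λ x → ∑ h λ y → ⟦ 2 * colourCount c i (c i x y) <? W * h ⟧

    colourCount+others : ∀ col → colourCount c i col + others col ≡ W * h
    colourCount+others col = begin
      colourCount c i col + others col
        ≡⟨ sym (∑-+ W _ _) ⟩
      (∑ W λ x → (∑ h λ y → ⟦ c i x y F.≟ col ⟧) + (∑ h λ y → ⟦ ¬? (c i x y F.≟ col) ⟧))
        ≡⟨ ∑-cong W (λ x → sym (∑-+ h _ _)) ⟩
      (∑ W λ x → ∑ h λ y → ⟦ c i x y F.≟ col ⟧ + ⟦ ¬? (c i x y F.≟ col) ⟧)
        ≡⟨ ∑-cong W (λ x → ∑-cong h (λ y → ⟦⟧+⟦¬⟧ (c i x y F.≟ col))) ⟩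
      (∑ W λ x → ∑ h λ y → 1)
        ≡⟨ ∑-cong W (λ x → trans (∑-const h 1) (NP.*-identityʳ h)) ⟩
      (∑ W λ x → h)
        ≡⟨ ∑-const W h ⟩
      W * h ∎
      where open ≡-Reasoning

    minority≤others : ∀ col → 2 * others col N.≤ W * h → minority N.≤ others col
    minority≤others col few = ∑-mono W λ x → ∑-mono h λ y →
      ⟦⟧-mono (2 * colourCount c i (c i x y) <? W * h) (¬? (c i x y F.≟ col))
        λ minor same → notMinor (subst (λ d → 2 * colourCount c i d N.< W * h) same minor)
      where
      notMinor : ¬ (2 * colourCount c i col N.< W * h)
      notMinor minor = NP.<-irrefl refl (begin-strict
        2 * (W * h)                           ≡⟨ cong (2 *_) (sym (colourCount+others col)) ⟩
        2 * (colourCount c i col + others col) ≡⟨ NP.*-distribˡ-+ 2 (colourCount c i col) (others col) ⟩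
        2 * colourCount c i col + 2 * others col <⟨ NP.+-mono-<-≤ minor few ⟩
        W * h + W * h                         ≡⟨ cong (W * h +_) (sym (NP.+-identityʳ (W * h))) ⟩
        2 * (W * h)                           ∎)
        where open NP.≤-Reasoning

    -- If row y₀ and column x₀ are monochromatic, every vertex (x,y) whose
    -- colour differs from that of (x₀,y₀) has a cut edge in column x and in
    -- row y; so at most (∑ columnCut)·(∑ rowCut) vertices avoid that colour.
    others≤cut-product : (x₀ : Fin W) (y₀ : Fin h) →
      columnCut x₀ ≡ 0 → rowCut y₀ ≡ 0 →
      others (c i x₀ y₀) N.≤ verticalCut c i * ∑ h rowCut
    others≤cut-product x₀ y₀ column₀ row₀ =
      NP.≤-trans (∑-mono W λ x → ∑-mono h λ y → ⟦⟧-≤ (¬? (c i x y F.≟ c₀)) (bothCut x y))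
                 (NP.≤-reflexive (∑-product W h columnCut rowCut))
      where
      c₀ : Fin k
      c₀ = c i x₀ y₀
      bothCut : ∀ x y → ¬ (c i x y ≡ c₀) → 1 N.≤ columnCut x * rowCut y
      bothCut x y differ with columnCut x in noColumn | rowCut y in noRow
      ... | zero  | _     = ⊥-elim (differ (trans
            (pathCut≡0⇒constant h (c i x) noColumn y y₀)
            (pathCut≡0⇒constant W (λ x → c i x y₀) row₀ x x₀)))
      ... | suc _ | zero  = ⊥-elim (differ (trans
            (pathCut≡0⇒constant W (λ x → c i x y) noRow x x₀)
            (pathCut≡0⇒constant h (c i x₀) column₀ y y₀)))
      ... | suc _ | suc _ = s≤s z≤n

    minority≤cut-product : horizontalCut c i + verticalCut c i N.< h → h N.≤ W →
      minority N.≤ verticalCut c i * horizontalCut c i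
    minority≤cut-product fewCuts wide =
      subst (minority N.≤_) (cong (V *_) (sym horizontalCut≡))
        (NP.≤-trans (minority≤others c₀ half) (others≤cut-product x₀ y₀ column₀ row₀))
      where
      V H : ℕ
      V = verticalCut c i
      H = ∑ h rowCut
      H+V<h : H + V N.< h
      H+V<h = subst (λ z → z + V N.< h) horizontalCut≡ fewCuts
      -- fewer than h rows and fewer than W columns carry a cut edge
      quietRow : Σ (Fin h) (λ y → rowCut y ≡ 0)
      quietRow = ∑<n⇒term≡0 h rowCut (NP.≤-<-trans (NP.m≤m+n H V) H+V<h)
      quietColumn : Σ (Fin W) (λ x → columnCut x ≡ 0)
      quietColumn = ∑<n⇒term≡0 W columnCut
        (NP.<-≤-trans (NP.≤-<-trans (NP.m≤n+m V H) H+V<h) wide)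
      y₀ : Fin h
      y₀ = proj₁ quietRow
      row₀ : rowCut y₀ ≡ 0
      row₀ = proj₂ quietRow
      x₀ : Fin W
      x₀ = proj₁ quietColumn
      column₀ : columnCut x₀ ≡ 0
      column₀ = proj₂ quietColumn
      c₀ : Fin k
      c₀ = c i x₀ y₀
      half : 2 * others c₀ N.≤ W * h
      half = begin
        2 * others c₀         ≤⟨ NP.*-monoʳ-≤ 2 (others≤cut-product x₀ y₀ column₀ row₀) ⟩
        2 * (V * H)           ≤⟨ 2ab≤[a+b]² V H ⟩
        (V + H) * (V + H)     ≤⟨ NP.*-mono-≤ V+H≤h V+H≤h ⟩
        h * h                 ≤⟨ NP.*-monoˡ-≤ h wide ⟩
        W * h                 ∎
        where
        open NP.≤-Reasoning
        V+H≤h : V + H N.≤ h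
        V+H≤h = NP.<⇒≤ (subst (N._< h) (NP.+-comm H V) H+V<h)

  minorityCount≤cutSize² : ∀ {k N' : ℕ} {w : Fin N' → ℕ} {h : ℕ}
    (c : Colouring k N' w h) → (∀ i → h N.≤ w i) → cutSize c N.< h →
    minorityCount c N.≤ cutSize c ^ 2
  minorityCount≤cutSize² {N' = N'} {h = h} c wide T<h = begin
    minorityCount c                  ≤⟨ ∑-mono N' (λ i → Gadget.minority≤cut-product c i (P<h i) (wide i)) ⟩
    ∑ N' (λ i → V i * H i)           ≤⟨ ∑-mono N' (λ i → NP.*-mono-≤ (NP.m≤n+m (V i) (H i)) (H≤T i)) ⟩
    ∑ N' (λ i → P i * T)             ≡⟨ ∑-*ʳ N' T P ⟩
    ∑ N' P * T                       ≤⟨ NP.*-monoˡ-≤ T ∑P≤T ⟩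
    T * T                            ≡⟨ cong (T *_) (sym (NP.*-identityʳ T)) ⟩
    T ^ 2                            ∎
    where
    open NP.≤-Reasoning
    T : ℕ
    T = cutSize c
    H V P : Fin N' → ℕ
    H = horizontalCut c
    V = verticalCut c
    P i = H i + V i
    ∑P≤T : ∑ N' P N.≤ T
    ∑P≤T = NP.m≤m+n _ _
    P≤T : ∀ i → P i N.≤ T
    P≤T i = NP.≤-trans (term≤∑ N' P i) ∑P≤T
    P<h : ∀ i → P i N.< h
    P<h i = NP.≤-<-trans (P≤T i) T<h
    H≤T : ∀ i → H i N.≤ T
    H≤T i = NP.≤-trans (NP.m≤m+n _ _) (P≤T i)

  -- In a 3-PARTITION instance every a_i is positive, so the gadget of
  -- width h·a_i is at least as wide as it is high.
  gadgetWide : ∀ {k} (I : ThreePartitionInstance k) (h : ℕ) (i : Fin (3 * k)) →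
    h N.≤ h * ThreePartitionInstance.a I i
  gadgetWide I h i = NP.m≤m*n h (a i) {{N.>-nonZero a>0}}
    where
    open ThreePartitionInstance I
    a>0 : 0 N.< a i
    a>0 = NP.*-cancelˡ-< 4 0 (a i) (NP.≤-<-trans z≤n (lower i))

open import Defs
open import Data.Nat using (ℕ; _*_; _∸_; _^_)
import Data.Nat as N
open import Data.Fin using (Fin)
open import Data.Rational using (ℚ; 0ℚ; 1ℚ; _≤_; _<_; _+_; _-_) renaming (_*_ to _*ℚ_)

import Data.Nat.Properties as NP
import Data.Nat.Coprimality as Coprime
open import Data.Integer using (+_)
import Data.Integer as ℤ
import Data.Integer.Properties as ℤP
import Data.Rational as ℚ
import Data.Rational.Properties as ℚP
import Data.Rational.Unnormalised as ℚᵘ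
import Data.Rational.Unnormalised.Properties as ℚᵘP
import Algebra.Properties.Group ℚP.+-0-group as ℚ-Group
open import Data.Product using (proj₁)
open import Relation.Binary.PropositionalEquality
open RowOfGrids using (minorityCount≤cutSize²; gadgetWide)

ℕ→ℚ-mkℚ : ∀ n → ℕ→ℚ n ≡ ℚ.mkℚ (+ n) 0 (Coprime.sym (Coprime.1-coprimeTo n))
ℕ→ℚ-mkℚ n = ℚP.normalize-coprime (Coprime.sym (Coprime.1-coprimeTo n))

+n*1≡+n : ∀ n → + n ℤ.* + 1 ≡ + n
+n*1≡+n n = ℤP.*-identityʳ (+ n)

ℕ→ℚ-mono-≤ : ∀ {a b} → a N.≤ b → ℕ→ℚ a ≤ ℕ→ℚ b
ℕ→ℚ-mono-≤ {a} {b} a≤b rewrite ℕ→ℚ-mkℚ a | ℕ→ℚ-mkℚ b =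
  ℚ.*≤* (subst₂ ℤ._≤_ (sym (+n*1≡+n a)) (sym (+n*1≡+n b)) (ℤ.+≤+ a≤b))

ℕ→ℚ-mono-< : ∀ {a b} → a N.< b → ℕ→ℚ a < ℕ→ℚ b
ℕ→ℚ-mono-< {a} {b} a<b rewrite ℕ→ℚ-mkℚ a | ℕ→ℚ-mkℚ b =
  ℚ.*<* (subst₂ ℤ._<_ (sym (+n*1≡+n a)) (sym (+n*1≡+n b)) (ℤ.+<+ a<b))

ℕ→ℚ-nonNeg : ∀ n → 0ℚ ≤ ℕ→ℚ n
ℕ→ℚ-nonNeg n = ℕ→ℚ-mono-≤ {0} {n} N.z≤n

ℕ→ℚ-cancel-< : ∀ {a b} → ℕ→ℚ a < ℕ→ℚ b → a N.< b
ℕ→ℚ-cancel-< a<b = NP.≰⇒> (λ b≤a → ℚP.<-irrefl refl (ℚP.<-≤-trans a<b (ℕ→ℚ-mono-≤ b≤a)))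

ℕ→ℚ-* : ∀ a b → ℕ→ℚ (a * b) ≡ ℕ→ℚ a *ℚ ℕ→ℚ b
ℕ→ℚ-* a b = ℚP.toℚᵘ-injective
  (ℚᵘP.≃-trans numerators (ℚᵘP.≃-sym (ℚP.toℚᵘ-homo-* (ℕ→ℚ a) (ℕ→ℚ b))))
  where
  numerators : ℚ.toℚᵘ (ℕ→ℚ (a * b)) ℚᵘ.≃ ℚ.toℚᵘ (ℕ→ℚ a) ℚᵘ.* ℚ.toℚᵘ (ℕ→ℚ b)
  numerators rewrite ℕ→ℚ-mkℚ a | ℕ→ℚ-mkℚ b | ℕ→ℚ-mkℚ (a * b) =
    ℚᵘP.≃-reflexive (cong (λ z → ℚᵘ.mkℚᵘ z 0) (ℤP.pos-* a b))

ℕ→ℚ-square : ∀ n → ℕ→ℚ (n ^ 2) ≡ ℕ→ℚ n *ℚ ℕ→ℚ n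
ℕ→ℚ-square n = trans (cong (λ z → ℕ→ℚ (n * z)) (NP.*-identityʳ n)) (ℕ→ℚ-* n n)

square-mono-< : ∀ {p q} → 0ℚ ≤ p → p < q → p *ℚ p < q *ℚ q
square-mono-< {p} {q} 0≤p p<q = ℚP.≤-<-trans
  (ℚP.*-monoʳ-≤-nonNeg p (ℚP.<⇒≤ p<q)) (ℚP.*-monoʳ-<-pos q p<q)
  where
  instance
    p≥0 : ℚ.NonNegative p
    p≥0 = ℚ.nonNegative 0≤p
    q>0 : ℚ.Positive q
    q>0 = ℚ.positive (ℚP.≤-<-trans 0≤p p<q)

*-nonNeg : ∀ {p q} → 0ℚ ≤ p → 0ℚ ≤ q → 0ℚ ≤ p *ℚ q
*-nonNeg {p} {q} 0≤p 0≤q = ℚP.nonNegative⁻¹ (p *ℚ q)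
  {{ℚP.nonNeg*nonNeg⇒nonNeg p {{ℚ.nonNegative 0≤p}} q {{ℚ.nonNegative 0≤q}}}}

≤-sub : ∀ {p q r} → p + q ≤ r → p ≤ r - q
≤-sub {p} {q} {r} p+q≤r =
  subst (_≤ r - q) (ℚ-Group.//-rightDividesʳ q p) (ℚP.+-monoˡ-≤ (ℚ.- q) p+q≤r)

sub-≤ : ∀ {p q} → 0ℚ ≤ q → p - q ≤ p
sub-≤ {p} 0≤q = subst (p - _ ≤_) (ℚP.+-identityʳ p) (ℚP.+-monoʳ-≤ p (ℚP.neg-antimono-≤ 0≤q))

lemma2 : (ε α : ℚ) → 0ℚ ≤ ε → 1ℚ ≤ α →
    (k : ℕ) → 1 N.≤ k → (I : ThreePartitionInstance k) →
    (h : ℕ) →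
    let w : Fin (3 * k) → ℕ
        w i = h * ThreePartitionInstance.a I i
        n = numVertices (3 * k) w h
        m = 3 * k ∸ 1
    in IsCeilSqrt ((ℕ→ℚ (3 * k) *ℚ α) *ℚ (ℕ→ℚ (3 * k) *ℚ α) + ε *ℚ ℕ→ℚ n) h →
       (c : Colouring k (3 * k) w h) →
       ℕ→ℚ (cutSize c) ≤ α *ℚ ℕ→ℚ m →
       ℕ→ℚ (minorityCount c) < ℕ→ℚ (h ^ 2) - ε *ℚ ℕ→ℚ n
lemma2 ε α 0≤ε 1≤α k 1≤k I h ceil c cut≤αm = begin-strict
  ℕ→ℚ (minorityCount c)  ≤⟨ ℕ→ℚ-mono-≤ (minorityCount≤cutSize² c (gadgetWide I h) T<h) ⟩
  ℕ→ℚ (T ^ 2)            <⟨ T²<h²-εn ⟩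
  ℕ→ℚ (h ^ 2) - E        ∎
  where
  open ℚP.≤-Reasoning
  T n : ℕ
  T = cutSize c
  n = numVertices (3 * k) (λ i → h * ThreePartitionInstance.a I i) h
  X E : ℚ
  X = ℕ→ℚ (3 * k) *ℚ α
  E = ε *ℚ ℕ→ℚ n

  T<X : ℕ→ℚ T < X
  T<X = ℚP.≤-<-trans cut≤αm (subst (α *ℚ _ <_) (ℚP.*-comm α (ℕ→ℚ (3 * k)))
    (ℚP.*-monoʳ-<-pos α (ℕ→ℚ-mono-< (NP.∸-monoʳ-< {n = 1} {o = 0} N.z<s 3k≥1))))
    where
    3k≥1 : 1 N.≤ 3 * k
    3k≥1 = NP.≤-trans 1≤k (NP.m≤n*m k 3)
    instance
      α>0 : ℚ.Positive α
      α>0 = ℚ.positive (ℚP.<-≤-trans (ℚP.positive⁻¹ 1ℚ) 1≤α)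

  0≤E : 0ℚ ≤ E
  0≤E = *-nonNeg 0≤ε (ℕ→ℚ-nonNeg n)

  T²<h²-εn : ℕ→ℚ (T ^ 2) < ℕ→ℚ (h ^ 2) - E
  T²<h²-εn = begin-strict
    ℕ→ℚ (T ^ 2)      ≡⟨ ℕ→ℚ-square T ⟩
    ℕ→ℚ T *ℚ ℕ→ℚ T   <⟨ square-mono-< (ℕ→ℚ-nonNeg T) T<X ⟩
    X *ℚ X           ≤⟨ ≤-sub (proj₁ ceil) ⟩  -- only X² + εn ≤ h² is needed
    ℕ→ℚ (h ^ 2) - E  ∎

  -- in particular T² < h², so every gadget has fewer than h cut edges
  T<h : T N.< h
  T<h = NP.≰⇒> λ h≤T → NP.<⇒≱ T²<h² (NP.^-monoˡ-≤ 2 h≤T)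
    where
    T²<h² : T ^ 2 N.< h ^ 2
    T²<h² = ℕ→ℚ-cancel-< (ℚP.<-≤-trans T²<h²-εn (sub-≤ 0≤E))
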